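{- Let $D$ be a pseudo-Yamanouchi pipe dream of size $n$, and let $D'$ be obtained from $D$ by a simple slide. Then $D'$ is pseudo-Yamanouchi.
   Context: A pipe dream of size $n$ is a tiling of the $n\times n$ grid (rows $1..n$ top to bottom, columns $1..n$ left to right) by cross tiles and elbow tiles, with every position $(i,j)$, $i+j\ge n+1$, an elbow tile (reducedness not required). A simple slide: if $D$ has a cross tile at $(r,c)$ and elbow tiles at $(r,c+1)$, $(r-1,c)$, $(r-1,c+1)$, then $D'$ is obtained by replacing the cross at $(r,c)$ by an elbow and the elbow at $(r-1,c+1)$ by a cross (the cross moves one step up and one step right, staying on the same antidiagonal). Reading word: scan rows from bottom to top, within each row left to right; each cross at $(r,c)$ appends $r+c-1$ to a word $\mathbf a=(a_1,\dots,a_\ell)$. Let $\mathrm{cnt}(k,j)$ be the number of occurrences of $j$ among $a_1,\dots,a_k$. A pipe dream is pseudo-Yamanouchi if $1+\mathrm{cnt}(k,j)\ge\mathrm{cnt}(k,j+1)$ for all $1\le k\le\ell$, $1\le j\le n-2$. -}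

module Defs where

open import Data.Nat using (ℕ; zero; suc; _+_; _∸_; _≤_; _≟_)
open import Data.Fin using (Fin; toℕ)
open import Data.Fin.Properties using () renaming (_≟_ to _≟ᶠ_)
open import Data.List using (List; []; _∷_; _++_; take; length; reverse; concatMap; map)
open import Data.List.Base using (allFin)
open import Data.Bool using (Bool; true; false; _∧_; if_then_else_)
open import Relation.Nullary.Decidable using (⌊_⌋)
open import Relation.Binary.PropositionalEquality using (_≡_)
open import Data.Empty using (⊥)

data Tile : Set where
  cross elbow : Tile

-- Rows/columns are Fin n, where the Fin index i corresponds to the
-- paper's 1-based row/column  toℕ i + 1.
-- Paper's condition: (i,j) with i+j ≥ n+1 (1-based) is an elbow,
-- i.e. with 0-based a,b : (a+1)+(b+1) ≥ n+1, i.e. n ≤ suc (a + b).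
record PipeDream (n : ℕ) : Set where
  field
    tile   : Fin n → Fin n → Tile
    below  : ∀ (i j : Fin n) → n ≤ suc (toℕ i + toℕ j) → tile i j ≡ elbow
open PipeDream public

record SimpleSlide {n : ℕ} (D D' : PipeDream n) : Set where
  field
    r r⁻ c c⁺  : Fin n
    r⁻-prev    : suc (toℕ r⁻) ≡ toℕ r
    c⁺-next    : toℕ c⁺ ≡ suc (toℕ c)
    cross-rc   : tile D r c ≡ cross
    elbow-rc⁺  : tile D r c⁺ ≡ elbow
    elbow-r⁻c  : tile D r⁻ c ≡ elbow
    elbow-r⁻c⁺ : tile D r⁻ c⁺ ≡ elbow
    new-rc     : tile D' r c ≡ elbow
    new-r⁻c⁺   : tile D' r⁻ c⁺ ≡ cross
    unchanged  : ∀ (i j : Fin n) →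
                 (i ≡ r → j ≡ c → ⊥) →
                 (i ≡ r⁻ → j ≡ c⁺ → ⊥) →
                 tile D' i j ≡ tile D i j

-- Letters contributed by one row (left to right): cross at 0-based (a,b)
-- gives 1-based r+c-1 = a + b + 1.
rowWord : {n : ℕ} → PipeDream n → Fin n → List ℕ
rowWord {n} D i = go (allFin n)
  where
  go : List (Fin n) → List ℕ
  go [] = []
  go (j ∷ js) with tile D i j
  ... | cross = suc (toℕ i + toℕ j) ∷ go js
  ... | elbow = go js

readingWord : {n : ℕ} → PipeDream n → List ℕ
readingWord {n} D = concatMap (rowWord D) (reverse (allFin n))

occ : ℕ → List ℕ → ℕ
occ j [] = 0
occ j (x ∷ xs) = if ⌊ x ≟ j ⌋ then suc (occ j xs) else occ j xs

cnt : List ℕ → ℕ → ℕ → ℕ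
cnt a k j = occ j (take k a)

PseudoYamanouchi : {n : ℕ} → PipeDream n → Set
PseudoYamanouchi {n} D =
  ∀ (k j : ℕ) → 1 ≤ k → k ≤ length (readingWord D) →
  1 ≤ j → j ≤ n ∸ 2 →
  cnt (readingWord D) k (suc j) ≤ suc (cnt (readingWord D) k j)

-- In the reading word, a simple slide from (r,c) to (r-1,c+1) takes the letter m = r+c-1 out of
-- row r and puts it back into row r-1: m moves to the right, past the crosses of row r to the
-- right of column c+1 (letters > m+1) and those of row r-1 to the left of column c (letters < m).
-- Moving a letter m to the right past letters different from m+1 keeps a word pseudo-Yamanouchi:
-- a prefix that lost its m contains no m+1 beyond the prefix that stops just before m, so the only
-- inequality involving the lost m, cnt(m+1) ≤ 1 + cnt(m), is inherited from that shorter prefix.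
module Submission where

open import Defs
open import Data.Nat using (ℕ; zero; suc; _+_; _∸_; _≤_; _<_; z≤n; s≤s; _≟_; _≤?_)
open import Data.Nat.Properties
  using (≤-refl; ≤-reflexive; <-trans; n<1+n; n≤1+n; m≤m+n; +-monoʳ-≤; +-monoʳ-<;
         +-mono-<; +-suc; +-identityʳ; <⇒≢; >⇒≢; ≰⇒≥; m≤n⇒∃[o]m+o≡n; suc-injective;
         module ≤-Reasoning)
open import Data.Fin using (Fin; toℕ; zero; suc) renaming (_<_ to _<ᶠ_)
import Data.Fin.Properties as Fin
open import Data.List using (List; []; _∷_; _++_; [_]; take; length; reverse; concat; concatMap; map; allFin)
open import Data.List.Properties using (++-assoc; ++-identityʳ; ++-monoid; take-all; reverse-++; reverse-map; concatMap-++; map-cong-local; map-tabulate; map-++)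
open import Data.List.Relation.Unary.All as All using (All; []; _∷_; universal)
open import Data.List.Relation.Unary.All.Properties using (++⁺; map⁺)
open import Data.Product using (_×_; _,_)
open import Function using (_∘_)
open import Data.Empty using (⊥-elim)
open import Relation.Nullary using (Dec; yes; no)
open import Relation.Binary.PropositionalEquality using (_≡_; _≢_; ≢-sym; refl; sym; trans; cong; cong₂; subst; subst₂; module ≡-Reasoning)
open import Algebra.Solver.Monoid (++-monoid ℕ) using (solve; _⊜_; _⊕_)

occ-≢ : ∀ {a x} xs → x ≢ a → occ a (x ∷ xs) ≡ occ a xs
occ-≢ {a} {x} xs x≢a with x ≟ a
... | yes x≡a = ⊥-elim (x≢a x≡a)
... | no _ = refl

occ-∷-≤ : ∀ a x xs → occ a xs ≤ occ a (x ∷ xs)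
occ-∷-≤ a x xs with x ≟ a
... | yes _ = n≤1+n _
... | no _ = ≤-refl

occ-swap : ∀ a x y zs → occ a (x ∷ y ∷ zs) ≡ occ a (y ∷ x ∷ zs)
occ-swap a x y zs with x ≟ a | y ≟ a
... | yes _ | yes _ = refl
... | yes _ | no _ = refl
... | no _ | yes _ = refl
... | no _ | no _ = refl

occ-++ : ∀ a xs ys → occ a (xs ++ ys) ≡ occ a xs + occ a ys
occ-++ a [] ys = refl
occ-++ a (x ∷ xs) ys with x ≟ a
... | yes _ = cong suc (occ-++ a xs ys)
... | no _ = occ-++ a xs ys

occ-avoided : ∀ a zs → All (_≢ a) zs → occ a zs ≡ 0
occ-avoided a [] [] = refl
occ-avoided a (z ∷ zs) (z≢a ∷ zs≢a) = trans (occ-≢ zs z≢a) (occ-avoided a zs zs≢a)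

occ-swap-++ : ∀ a xs x y zs → occ a (xs ++ x ∷ y ∷ zs) ≡ occ a (xs ++ y ∷ x ∷ zs)
occ-swap-++ a xs x y zs = begin
  occ a (xs ++ x ∷ y ∷ zs)       ≡⟨ occ-++ a xs (x ∷ y ∷ zs) ⟩
  occ a xs + occ a (x ∷ y ∷ zs)  ≡⟨ cong (occ a xs +_) (occ-swap a x y zs) ⟩
  occ a xs + occ a (y ∷ x ∷ zs)  ≡⟨ occ-++ a xs (y ∷ x ∷ zs) ⟨
  occ a (xs ++ y ∷ x ∷ zs)       ∎
  where open ≡-Reasoning

take-++-≤ : ∀ {A : Set} k (xs ys : List A) → k ≤ length xs → take k (xs ++ ys) ≡ take k xs
take-++-≤ zero xs ys _ = refl
take-++-≤ (suc k) (x ∷ xs) ys (s≤s k≤) = cong (x ∷_) (take-++-≤ k xs ys k≤)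

take-length-+-++ : ∀ {A : Set} (xs ys : List A) i → take (length xs + i) (xs ++ ys) ≡ xs ++ take i ys
take-length-+-++ [] ys i = refl
take-length-+-++ (x ∷ xs) ys i = cong (x ∷_) (take-length-+-++ xs ys i)

PseudoBallot : ℕ → List ℕ → Set
PseudoBallot n p = ∀ j → 1 ≤ j → j ≤ n ∸ 2 → occ (suc j) p ≤ suc (occ j p)

PseudoYamanouchiWord : ℕ → List ℕ → Set
PseudoYamanouchiWord n w = ∀ k → PseudoBallot n (take k w)

record LetterMovedRight (w w′ : List ℕ) : Set where
  field
    prefix block suffix : List ℕ
    moved          : ℕ
    before         : w ≡ prefix ++ moved ∷ block ++ suffix
    after          : w′ ≡ prefix ++ block ++ moved ∷ suffix
    block-avoids   : All (_≢ suc moved) block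

module _ {n : ℕ} where

  pseudoBallot-[] : PseudoBallot n []
  pseudoBallot-[] _ _ _ = z≤n

  pseudoBallot-resp : ∀ p q → (∀ a → occ a p ≡ occ a q) → PseudoBallot n p → PseudoBallot n q
  pseudoBallot-resp p q p≈q bal j 1≤j j≤ =
    subst₂ (λ s t → s ≤ suc t) (p≈q (suc j)) (p≈q j) (bal j 1≤j j≤)

  pseudoBallot-delete : ∀ xs m zs → All (_≢ suc m) zs →
    PseudoBallot n xs → PseudoBallot n (xs ++ m ∷ zs) → PseudoBallot n (xs ++ zs)
  pseudoBallot-delete xs m zs zs≢m+1 bal-xs bal-xs-m-zs j 1≤j j≤ with j ≟ m
  ... | yes refl = begin
    occ (suc j) (xs ++ zs)            ≡⟨ occ-++ (suc j) xs zs ⟩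
    occ (suc j) xs + occ (suc j) zs   ≡⟨ cong (occ (suc j) xs +_) (occ-avoided (suc j) zs zs≢m+1) ⟩
    occ (suc j) xs + 0                ≡⟨ +-identityʳ _ ⟩
    occ (suc j) xs                    ≤⟨ bal-xs j 1≤j j≤ ⟩
    suc (occ j xs)                    ≤⟨ s≤s (m≤m+n _ _) ⟩
    suc (occ j xs + occ j zs)         ≡⟨ cong suc (occ-++ j xs zs) ⟨
    suc (occ j (xs ++ zs))            ∎
    where open ≤-Reasoning
  ... | no j≢m = begin
    occ (suc j) (xs ++ zs)                 ≡⟨ occ-++ (suc j) xs zs ⟩
    occ (suc j) xs + occ (suc j) zs        ≤⟨ +-monoʳ-≤ (occ (suc j) xs) (occ-∷-≤ (suc j) m zs) ⟩
    occ (suc j) xs + occ (suc j) (m ∷ zs)  ≡⟨ occ-++ (suc j) xs (m ∷ zs) ⟨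
    occ (suc j) (xs ++ m ∷ zs)             ≤⟨ bal-xs-m-zs j 1≤j j≤ ⟩
    suc (occ j (xs ++ m ∷ zs))             ≡⟨ cong suc (occ-++ j xs (m ∷ zs)) ⟩
    suc (occ j xs + occ j (m ∷ zs))        ≡⟨ cong (λ t → suc (occ j xs + t)) (occ-≢ zs (≢-sym j≢m)) ⟩
    suc (occ j xs + occ j zs)              ≡⟨ cong suc (occ-++ j xs zs) ⟨
    suc (occ j (xs ++ zs))                 ∎
    where open ≤-Reasoning

  pseudoYamanouchiWord-++⁺ : ∀ xs ys →
    (∀ k → k ≤ length xs → PseudoBallot n (take k xs)) →
    (∀ i → PseudoBallot n (xs ++ take i ys)) →
    PseudoYamanouchiWord n (xs ++ ys)
  pseudoYamanouchiWord-++⁺ xs ys inside beyond k with k ≤? length xs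
  ... | yes k≤ = subst (PseudoBallot n) (sym (take-++-≤ k xs ys k≤)) (inside k k≤)
  ... | no k≰ with m≤n⇒∃[o]m+o≡n (≰⇒≥ k≰)
  ...   | i , refl = subst (PseudoBallot n) (sym (take-length-+-++ xs ys i)) (beyond i)

  pseudoYamanouchiWord-++⁻ : ∀ xs ys → PseudoYamanouchiWord n (xs ++ ys) →
    ∀ i → PseudoBallot n (xs ++ take i ys)
  pseudoYamanouchiWord-++⁻ xs ys yam i =
    subst (PseudoBallot n) (take-length-+-++ xs ys i) (yam (length xs + i))

  pseudoYamanouchiWord-prefix : ∀ xs ys → PseudoYamanouchiWord n (xs ++ ys) →
    ∀ k → k ≤ length xs → PseudoBallot n (take k xs)
  pseudoYamanouchiWord-prefix xs ys yam k k≤ =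
    subst (PseudoBallot n) (take-++-≤ k xs ys k≤) (yam k)

  pseudoYamanouchiWord-swap : ∀ xs m y zs → y ≢ suc m →
    PseudoYamanouchiWord n (xs ++ m ∷ y ∷ zs) → PseudoYamanouchiWord n (xs ++ y ∷ m ∷ zs)
  pseudoYamanouchiWord-swap xs m y zs y≢m+1 yam =
    pseudoYamanouchiWord-++⁺ xs (y ∷ m ∷ zs) (pseudoYamanouchiWord-prefix xs (m ∷ y ∷ zs) yam) beyond
    where
    old : ∀ i → PseudoBallot n (xs ++ take i (m ∷ y ∷ zs))
    old = pseudoYamanouchiWord-++⁻ xs (m ∷ y ∷ zs) yam

    beyond : ∀ i → PseudoBallot n (xs ++ take i (y ∷ m ∷ zs))
    beyond zero = old zero
    beyond (suc zero) =
      pseudoBallot-delete xs m [ y ] (y≢m+1 ∷ []) (subst (PseudoBallot n) (++-identityʳ xs) (old 0)) (old 2)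
    beyond (suc (suc i)) =
      pseudoBallot-resp (xs ++ m ∷ y ∷ take i zs) (xs ++ y ∷ m ∷ take i zs)
        (λ a → occ-swap-++ a xs m y (take i zs)) (old (2 + i))

  pseudoYamanouchiWord-moveRight : ∀ xs m ys zs → All (_≢ suc m) ys →
    PseudoYamanouchiWord n (xs ++ m ∷ ys ++ zs) → PseudoYamanouchiWord n (xs ++ ys ++ m ∷ zs)
  pseudoYamanouchiWord-moveRight xs m [] zs [] yam = yam
  pseudoYamanouchiWord-moveRight xs m (y ∷ ys) zs (y≢m+1 ∷ ys≢m+1) yam =
    subst (PseudoYamanouchiWord n) (++-assoc xs [ y ] (ys ++ m ∷ zs))
      (pseudoYamanouchiWord-moveRight (xs ++ [ y ]) m ys zs ys≢m+1
        (subst (PseudoYamanouchiWord n) (sym (++-assoc xs [ y ] (m ∷ ys ++ zs)))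
          (pseudoYamanouchiWord-swap xs m y (ys ++ zs) y≢m+1 yam)))

  pseudoYamanouchiWord-letterMovedRight : ∀ {w w′} → LetterMovedRight w w′ →
    PseudoYamanouchiWord n w → PseudoYamanouchiWord n w′
  pseudoYamanouchiWord-letterMovedRight mv yam =
    subst (PseudoYamanouchiWord n) (sym after)
      (pseudoYamanouchiWord-moveRight prefix moved block suffix block-avoids
        (subst (PseudoYamanouchiWord n) before yam))
    where open LetterMovedRight mv

  pseudoYamanouchiWord-fromBounded : ∀ w →
    (∀ k → 1 ≤ k → k ≤ length w → PseudoBallot n (take k w)) → PseudoYamanouchiWord n w
  pseudoYamanouchiWord-fromBounded w bounded k = prefix k (k ≤? length w)
    where
    upTo : ∀ k → k ≤ length w → PseudoBallot n (take k w)
    upTo zero _ = pseudoBallot-[]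
    upTo (suc k) k≤ = bounded (suc k) (s≤s z≤n) k≤

    prefix : ∀ k → Dec (k ≤ length w) → PseudoBallot n (take k w)
    prefix k (yes k≤) = upTo k k≤
    prefix k (no k≰) =
      subst (PseudoBallot n) (trans (take-all (length w) w ≤-refl) (sym (take-all k w (≰⇒≥ k≰))))
        (upTo (length w) ≤-refl)

pseudoYamanouchi⇒word : ∀ {n} (D : PipeDream n) → PseudoYamanouchi D → PseudoYamanouchiWord n (readingWord D)
pseudoYamanouchi⇒word {n} D py =
  pseudoYamanouchiWord-fromBounded {n} (readingWord D) (λ k 1≤k k≤ j → py k j 1≤k k≤)

word⇒pseudoYamanouchi : ∀ {n} (D : PipeDream n) → PseudoYamanouchiWord n (readingWord D) → PseudoYamanouchi D
word⇒pseudoYamanouchi D yam k j _ _ = yam k j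

label : ∀ {n} → Fin n → Fin n → ℕ
label i j = suc (toℕ i + toℕ j)

-- `rowWord` scans its row with an inaccessible local function. Here `go` is a metavariable that the
-- with-abstraction in `go-allFin` solves to that very function, which makes it usable on any columns.
rowLetters : ∀ {n} → PipeDream n → Fin n → List (Fin n) → List ℕ
rowLetters {n} D i = go
  where
  go : List (Fin n) → List ℕ
  go = _
  go-allFin : go (allFin n) ≡ rowWord D i
  go-allFin with allFin n
  ... | _ = refl

module _ {n : ℕ} (D : PipeDream n) (i : Fin n) where

  rowLetters-cross : ∀ {j} js → tile D i j ≡ cross → rowLetters D i (j ∷ js) ≡ label i j ∷ rowLetters D i js
  rowLetters-cross js eq rewrite eq = refl

  rowLetters-elbow : ∀ {j} js → tile D i j ≡ elbow → rowLetters D i (j ∷ js) ≡ rowLetters D i js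
  rowLetters-elbow js eq rewrite eq = refl

  rowLetters-++ : ∀ js ks → rowLetters D i (js ++ ks) ≡ rowLetters D i js ++ rowLetters D i ks
  rowLetters-++ [] ks = refl
  rowLetters-++ (j ∷ js) ks with tile D i j
  ... | cross = cong (label i j ∷_) (rowLetters-++ js ks)
  ... | elbow = rowLetters-++ js ks

  rowLetters-All : ∀ {P : ℕ → Set} js → All (λ j → P (label i j)) js → All P (rowLetters D i js)
  rowLetters-All [] [] = []
  rowLetters-All (j ∷ js) (pj ∷ pjs) with tile D i j
  ... | cross = pj ∷ rowLetters-All js pjs
  ... | elbow = rowLetters-All js pjs

rowLetters-cong : ∀ {n} (D D′ : PipeDream n) i js → All (λ j → tile D′ i j ≡ tile D i j) js →
  rowLetters D′ i js ≡ rowLetters D i js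
rowLetters-cong D D′ i [] [] = refl
rowLetters-cong D D′ i (j ∷ js) (eq ∷ eqs) with tile D′ i j | tile D i j
rowLetters-cong D D′ i (j ∷ js) (refl ∷ eqs) | cross | _ = cong (label i j ∷_) (rowLetters-cong D D′ i js eqs)
rowLetters-cong D D′ i (j ∷ js) (refl ∷ eqs) | elbow | _ = rowLetters-cong D D′ i js eqs

record AdjacentSplit {n} (a b : Fin n) : Set where
  field
    left right : List (Fin n)
    allFin-≡   : allFin n ≡ left ++ a ∷ b ∷ right
    left-<     : All (_<ᶠ a) left
    right->    : All (b <ᶠ_) right

allFin-suc : ∀ n → allFin (suc n) ≡ zero ∷ map suc (allFin n)
allFin-suc n = cong (zero ∷_) (sym (map-tabulate (λ i → i) suc))

allFin-adjacentSplit : ∀ {n} (a b : Fin n) → toℕ b ≡ suc (toℕ a) → AdjacentSplit a b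
allFin-adjacentSplit {suc (suc n)} zero (suc zero) refl = record
  { left = []
  ; right = map suc (map suc (allFin n))
  ; allFin-≡ = trans (allFin-suc (suc n)) (cong (λ is → zero ∷ map suc is) (allFin-suc n))
  ; left-< = []
  ; right-> = map⁺ (map⁺ (universal (λ _ → s≤s (s≤s z≤n)) (allFin n)))
  }
allFin-adjacentSplit {suc n} (suc a) (suc b) eq = record
  { left = zero ∷ map suc left
  ; right = map suc right
  ; allFin-≡ = trans (allFin-suc n)
      (cong (zero ∷_) (trans (cong (map suc) allFin-≡) (map-++ suc left (a ∷ b ∷ right))))
  ; left-< = s≤s z≤n ∷ map⁺ (All.map s≤s left-<)
  ; right-> = map⁺ (All.map s≤s right->)
  }
  where open AdjacentSplit (allFin-adjacentSplit a b (suc-injective eq))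

rowsWord : ∀ {n} → PipeDream n → List (Fin n) → List ℕ
rowsWord D is = concatMap (rowWord D) (reverse is)

rowsWord-cong : ∀ {n} (D D′ : PipeDream n) is → All (λ i → rowWord D′ i ≡ rowWord D i) is →
  rowsWord D′ is ≡ rowsWord D is
rowsWord-cong D D′ is eqs = begin
  concat (map (rowWord D′) (reverse is))  ≡⟨ cong concat (reverse-map (rowWord D′) is) ⟩
  concat (reverse (map (rowWord D′) is))  ≡⟨ cong (concat ∘ reverse) (map-cong-local eqs) ⟩
  concat (reverse (map (rowWord D) is))   ≡⟨ cong concat (reverse-map (rowWord D) is) ⟨
  concat (map (rowWord D) (reverse is))   ∎
  where open ≡-Reasoning

reverse-around : ∀ {A : Set} (xs : List A) a b ys → reverse (xs ++ a ∷ b ∷ ys) ≡ reverse ys ++ b ∷ a ∷ reverse xs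
reverse-around xs a b ys = begin
  reverse (xs ++ a ∷ b ∷ ys)                   ≡⟨ reverse-++ xs (a ∷ b ∷ ys) ⟩
  reverse ((a ∷ b ∷ []) ++ ys) ++ reverse xs   ≡⟨ cong (_++ reverse xs) (reverse-++ (a ∷ b ∷ []) ys) ⟩
  (reverse ys ++ b ∷ a ∷ []) ++ reverse xs     ≡⟨ ++-assoc (reverse ys) (b ∷ a ∷ []) (reverse xs) ⟩
  reverse ys ++ b ∷ a ∷ reverse xs             ∎
  where open ≡-Reasoning

readingWord-around : ∀ {n} (D : PipeDream n) {a b : Fin n} (split : AdjacentSplit a b) →
  readingWord D ≡ rowsWord D (AdjacentSplit.right split) ++ rowWord D b ++ rowWord D a
                    ++ rowsWord D (AdjacentSplit.left split)
readingWord-around D {a} {b} split =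
  trans (cong (concatMap (rowWord D)) (trans (cong reverse allFin-≡) (reverse-around left a b right)))
        (concatMap-++ (rowWord D) (reverse right) (b ∷ a ∷ reverse left))
  where open AdjacentSplit split

module _ {n : ℕ} {D D′ : PipeDream n} (slide : SimpleSlide D D′) where
  open SimpleSlide slide

  r⁻<r : r⁻ <ᶠ r
  r⁻<r = ≤-reflexive r⁻-prev

  c<c⁺ : c <ᶠ c⁺
  c<c⁺ = ≤-reflexive (sym c⁺-next)

  rows : AdjacentSplit r⁻ r
  rows = allFin-adjacentSplit r⁻ r (sym r⁻-prev)

  module Rows = AdjacentSplit rows
  module Cols = AdjacentSplit (allFin-adjacentSplit c c⁺ c⁺-next)

  m : ℕ
  m = label r c

  label-r⁻c⁺ : label r⁻ c⁺ ≡ m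
  label-r⁻c⁺ = begin
    suc (toℕ r⁻ + toℕ c⁺)      ≡⟨ cong (λ t → suc (toℕ r⁻ + t)) c⁺-next ⟩
    suc (toℕ r⁻ + suc (toℕ c)) ≡⟨ cong suc (+-suc (toℕ r⁻) (toℕ c)) ⟩
    suc (suc (toℕ r⁻) + toℕ c) ≡⟨ cong (λ t → suc (t + toℕ c)) r⁻-prev ⟩
    suc (toℕ r + toℕ c)        ∎
    where open ≡-Reasoning

  rowWord-offRows : ∀ {i} → i ≢ r → i ≢ r⁻ → rowWord D′ i ≡ rowWord D i
  rowWord-offRows {i} i≢r i≢r⁻ = rowLetters-cong D D′ i (allFin n)
    (universal (λ j → unchanged i j (λ i≡r _ → i≢r i≡r) (λ i≡r⁻ _ → i≢r⁻ i≡r⁻)) (allFin n))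

  rowLetters-offCols : ∀ i js → All (λ j → j ≢ c × j ≢ c⁺) js → rowLetters D′ i js ≡ rowLetters D i js
  rowLetters-offCols i js offs = rowLetters-cong D D′ i js
    (All.map (λ (j≢c , j≢c⁺) → unchanged i _ (λ _ j≡c → j≢c j≡c) (λ _ j≡c⁺ → j≢c⁺ j≡c⁺)) offs)

  rowsAbove-unchanged : rowsWord D′ Rows.left ≡ rowsWord D Rows.left
  rowsAbove-unchanged = rowsWord-cong D D′ Rows.left
    (All.map (λ i<r⁻ → rowWord-offRows (Fin.<⇒≢ (Fin.<-trans i<r⁻ r⁻<r)) (Fin.<⇒≢ i<r⁻)) Rows.left-<)

  rowsBelow-unchanged : rowsWord D′ Rows.right ≡ rowsWord D Rows.right
  rowsBelow-unchanged = rowsWord-cong D D′ Rows.right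
    (All.map (λ r<i → rowWord-offRows (≢-sym (Fin.<⇒≢ r<i)) (≢-sym (Fin.<⇒≢ (Fin.<-trans r⁻<r r<i))))
             Rows.right->)

  colsLeft-unchanged : ∀ i → rowLetters D′ i Cols.left ≡ rowLetters D i Cols.left
  colsLeft-unchanged i = rowLetters-offCols i Cols.left
    (All.map (λ j<c → Fin.<⇒≢ j<c , Fin.<⇒≢ (Fin.<-trans j<c c<c⁺)) Cols.left-<)

  colsRight-unchanged : ∀ i → rowLetters D′ i Cols.right ≡ rowLetters D i Cols.right
  colsRight-unchanged i = rowLetters-offCols i Cols.right
    (All.map (λ c⁺<j → ≢-sym (Fin.<⇒≢ (Fin.<-trans c<c⁺ c⁺<j)) , ≢-sym (Fin.<⇒≢ c⁺<j)) Cols.right->)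

  G₁ G₂ H₁ H₂ Below Above : List ℕ
  G₁ = rowLetters D r Cols.left
  G₂ = rowLetters D r Cols.right
  H₁ = rowLetters D r⁻ Cols.left
  H₂ = rowLetters D r⁻ Cols.right
  Below = rowsWord D Rows.right
  Above = rowsWord D Rows.left

  rowWord-aroundCols : ∀ E i → rowWord E i ≡ rowLetters E i Cols.left ++ rowLetters E i (c ∷ c⁺ ∷ Cols.right)
  rowWord-aroundCols E i =
    trans (cong (rowLetters E i) Cols.allFin-≡) (rowLetters-++ E i Cols.left (c ∷ c⁺ ∷ Cols.right))

  rowWord-r : rowWord D r ≡ G₁ ++ m ∷ G₂
  rowWord-r = trans (rowWord-aroundCols D r) (cong (G₁ ++_)
    (trans (rowLetters-cross D r (c⁺ ∷ Cols.right) cross-rc)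
           (cong (m ∷_) (rowLetters-elbow D r Cols.right elbow-rc⁺))))

  rowWord-r⁻ : rowWord D r⁻ ≡ H₁ ++ H₂
  rowWord-r⁻ = trans (rowWord-aroundCols D r⁻) (cong (H₁ ++_)
    (trans (rowLetters-elbow D r⁻ (c⁺ ∷ Cols.right) elbow-r⁻c)
           (rowLetters-elbow D r⁻ Cols.right elbow-r⁻c⁺)))

  rowWord′-r : rowWord D′ r ≡ G₁ ++ G₂
  rowWord′-r = trans (rowWord-aroundCols D′ r) (cong₂ _++_ (colsLeft-unchanged r)
    (trans (rowLetters-elbow D′ r (c⁺ ∷ Cols.right) new-rc)
      (trans (rowLetters-elbow D′ r Cols.right elbow′-rc⁺) (colsRight-unchanged r))))
    where
    elbow′-rc⁺ : tile D′ r c⁺ ≡ elbow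
    elbow′-rc⁺ = trans
      (unchanged r c⁺ (λ _ c⁺≡c → Fin.<⇒≢ c<c⁺ (sym c⁺≡c)) (λ r≡r⁻ _ → Fin.<⇒≢ r⁻<r (sym r≡r⁻)))
      elbow-rc⁺

  rowWord′-r⁻ : rowWord D′ r⁻ ≡ H₁ ++ m ∷ H₂
  rowWord′-r⁻ = trans (rowWord-aroundCols D′ r⁻) (cong₂ _++_ (colsLeft-unchanged r⁻)
    (trans (rowLetters-elbow D′ r⁻ (c⁺ ∷ Cols.right) elbow′-r⁻c)
      (trans (rowLetters-cross D′ r⁻ Cols.right new-r⁻c⁺)
             (cong₂ _∷_ label-r⁻c⁺ (colsRight-unchanged r⁻)))))
    where
    elbow′-r⁻c : tile D′ r⁻ c ≡ elbow
    elbow′-r⁻c = trans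
      (unchanged r⁻ c (λ r⁻≡r _ → Fin.<⇒≢ r⁻<r r⁻≡r) (λ _ c≡c⁺ → Fin.<⇒≢ c<c⁺ c≡c⁺))
      elbow-r⁻c

  G₂-above-m+1 : All (suc m <_) G₂
  G₂-above-m+1 = rowLetters-All D r Cols.right (All.map above Cols.right->)
    where
    above : ∀ {j} → c⁺ <ᶠ j → suc m < label r j
    above {j} c⁺<j = s≤s (subst (_< toℕ r + toℕ j) (+-suc (toℕ r) (toℕ c))
      (+-monoʳ-< (toℕ r) (subst (_< toℕ j) c⁺-next c⁺<j)))

  H₁-below-m : All (_< m) H₁
  H₁-below-m = rowLetters-All D r⁻ Cols.left (All.map (λ j<c → s≤s (+-mono-< r⁻<r j<c)) Cols.left-<)

  simpleSlide-letterMovedRight : LetterMovedRight (readingWord D) (readingWord D′)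
  simpleSlide-letterMovedRight = record
    { prefix = Below ++ G₁
    ; block = G₂ ++ H₁
    ; suffix = H₂ ++ Above
    ; moved = m
    ; before = begin
        readingWord D                                       ≡⟨ readingWord-around D rows ⟩
        Below ++ rowWord D r ++ rowWord D r⁻ ++ Above       ≡⟨ cong₂ (λ u v → Below ++ u ++ v ++ Above) rowWord-r rowWord-r⁻ ⟩
        Below ++ (G₁ ++ m ∷ G₂) ++ (H₁ ++ H₂) ++ Above      ≡⟨ reassoc-before Below G₁ [ m ] G₂ H₁ H₂ Above ⟩
        (Below ++ G₁) ++ m ∷ (G₂ ++ H₁) ++ (H₂ ++ Above)    ∎
    ; after = begin
        readingWord D′                                      ≡⟨ readingWord-around D′ rows ⟩
        rowsWord D′ Rows.right ++ rowWord D′ r ++ rowWord D′ r⁻ ++ rowsWord D′ Rows.left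
          ≡⟨ cong₂ (λ u v → u ++ rowWord D′ r ++ rowWord D′ r⁻ ++ v) rowsBelow-unchanged rowsAbove-unchanged ⟩
        Below ++ rowWord D′ r ++ rowWord D′ r⁻ ++ Above     ≡⟨ cong₂ (λ u v → Below ++ u ++ v ++ Above) rowWord′-r rowWord′-r⁻ ⟩
        Below ++ (G₁ ++ G₂) ++ (H₁ ++ m ∷ H₂) ++ Above      ≡⟨ reassoc-after Below G₁ [ m ] G₂ H₁ H₂ Above ⟩
        (Below ++ G₁) ++ (G₂ ++ H₁) ++ m ∷ (H₂ ++ Above)    ∎
    ; block-avoids = ++⁺ (All.map >⇒≢ G₂-above-m+1)
                         (All.map (λ x<m → <⇒≢ (<-trans x<m (n<1+n m))) H₁-below-m)
    }
    where
    open ≡-Reasoning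
    reassoc-before : ∀ (P G₁ M G₂ H₁ H₂ Q : List ℕ) →
      P ++ (G₁ ++ M ++ G₂) ++ (H₁ ++ H₂) ++ Q ≡ (P ++ G₁) ++ M ++ (G₂ ++ H₁) ++ (H₂ ++ Q)
    reassoc-before = solve 7 (λ P G₁ M G₂ H₁ H₂ Q →
      P ⊕ (G₁ ⊕ M ⊕ G₂) ⊕ (H₁ ⊕ H₂) ⊕ Q ⊜ (P ⊕ G₁) ⊕ M ⊕ (G₂ ⊕ H₁) ⊕ (H₂ ⊕ Q)) refl
    reassoc-after : ∀ (P G₁ M G₂ H₁ H₂ Q : List ℕ) →
      P ++ (G₁ ++ G₂) ++ (H₁ ++ M ++ H₂) ++ Q ≡ (P ++ G₁) ++ (G₂ ++ H₁) ++ M ++ (H₂ ++ Q)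
    reassoc-after = solve 7 (λ P G₁ M G₂ H₁ H₂ Q →
      P ⊕ (G₁ ⊕ G₂) ⊕ (H₁ ⊕ M ⊕ H₂) ⊕ Q ⊜ (P ⊕ G₁) ⊕ (G₂ ⊕ H₁) ⊕ M ⊕ (H₂ ⊕ Q)) refl

lemma4p2 : ∀ (n : ℕ) (D D' : PipeDream n) →
    PseudoYamanouchi D → SimpleSlide D D' → PseudoYamanouchi D'
lemma4p2 n D D' py slide =
  word⇒pseudoYamanouchi D'
    (pseudoYamanouchiWord-letterMovedRight {n} (simpleSlide-letterMovedRight slide) (pseudoYamanouchi⇒word D py))
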